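{- Let $G$ be an ordered group (possibly equipped with additional structure) whose complete theory is inp-minimal. Then $G$ is abelian.
   Context: An ordered group is a group with a linear order invariant under left and right multiplication. An inp-pattern of length $\kappa$ (in the variable $x$) is a sequence $(\phi^\alpha(x,y),k^\alpha)_{\alpha<\kappa}$ of formulas and positive integers for which there is an array $\langle a^\alpha_i : \alpha<\kappa, i<\lambda\rangle$, $\lambda\ge\omega$, such that for each $\alpha$ the set $\{\phi^\alpha(x,a^\alpha_i): i<\lambda\}$ is $k^\alpha$-inconsistent, and for every $\eta\in\lambda^\kappa$ the set $\{\phi^\alpha(x,a^\alpha_{\eta(\alpha)}):\alpha<\kappa\}$ is consistent. A theory is inp-minimal if there is no inp-pattern of length two with $x$ a single variable. -}

module Defs where

open import Level using (0ℓ)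
open import Data.Nat using (ℕ; zero; suc; _≤_)
open import Data.Fin using (Fin; zero; suc)
open import Data.Vec using (Vec; []; _∷_)
open import Data.Product using (Σ; ∃; _×_; _,_)
open import Data.Sum using (_⊎_)
open import Data.Empty using (⊥)
open import Relation.Nullary using (¬_)
open import Relation.Binary.PropositionalEquality using (_≡_)
open import Function.Definitions using (Injective)

record Signature : Set₁ where
  field
    FunSym : ℕ → Set
    RelSym : ℕ → Set

module _ (L : Signature) where
  open Signature L

  data Term (n : ℕ) : Set where
    var : Fin n → Term n
    app : ∀ {k} → FunSym k → Vec (Term n) k → Term n

  -- formulas in n free variables (classical connectives are definable)
  data Formula : ℕ → Set where
    falsum : ∀ {n} → Formula n
    equal  : ∀ {n} → Term n → Term n → Formula n
    rel    : ∀ {n k} → RelSym k → Vec (Term n) k → Formula n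
    imp    : ∀ {n} → Formula n → Formula n → Formula n
    all    : ∀ {n} → Formula (suc n) → Formula n

  Sentence : Set
  Sentence = Formula 0

  record Structure : Set₁ where
    field
      Carrier : Set
      funI    : ∀ {k} → FunSym k → Vec Carrier k → Carrier
      relI    : ∀ {k} → RelSym k → Vec Carrier k → Set

module _ {L : Signature} (M : Structure L) where
  open Signature L
  open Structure M

  Env : ℕ → Set
  Env n = Fin n → Carrier

  extend : ∀ {n} → Carrier → Env n → Env (suc n)
  extend c ρ zero    = c
  extend c ρ (suc i) = ρ i

  mutual
    evalTerm : ∀ {n} → Env n → Term L n → Carrier
    evalTerm ρ (var i)    = ρ i
    evalTerm ρ (app f ts) = funI f (evalTerms ρ ts)

    evalTerms : ∀ {n k} → Env n → Vec (Term L n) k → Vec Carrier k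
    evalTerms ρ []       = []
    evalTerms ρ (t ∷ ts) = evalTerm ρ t ∷ evalTerms ρ ts

  Sat : ∀ {n} → Formula L n → Env n → Set
  Sat falsum       ρ = ⊥
  Sat (equal t u)  ρ = evalTerm ρ t ≡ evalTerm ρ u
  Sat (rel R ts)   ρ = relI R (evalTerms ρ ts)
  Sat (imp φ ψ)    ρ = Sat φ ρ → Sat ψ ρ
  Sat (all φ)      ρ = (c : Carrier) → Sat φ (extend c ρ)

  ∅ : Env 0
  ∅ ()

-- elementary equivalence: M and N satisfy the same sentences,
-- i.e. M is a model of the complete theory Th(N)
_≡ₑ_ : {L : Signature} → Structure L → Structure L → Set
_≡ₑ_ {L} M N = (σ : Sentence L) → (Sat M σ (∅ M) → Sat N σ (∅ N)) × (Sat N σ (∅ N) → Sat M σ (∅ M))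

-- A partitioned formula φ(x ; y) with x a single variable and y of
-- length m: a formula in 1 + m free variables, variable 0 being x.
--
-- An inp-pattern of length two for the complete theory T = Th(G),
-- with its witnessing array realised in a model M of T.  Since
-- k-inconsistency involves only finitely many instances, and since each
-- path {φ⁰(x,a⁰_η(0)), φ¹(x,a¹_η(1))} is a finite set, "consistent with T"
-- and "k-inconsistent" may equivalently be evaluated in M itself.
record InpPattern₂ {L : Signature} (M : Structure L) : Set₁ where
  open Structure M
  field
    m     : Fin 2 → ℕ
    φ     : (α : Fin 2) → Formula L (suc (m α))
    k     : Fin 2 → ℕ
    k-pos : (α : Fin 2) → 1 ≤ k α
    I     : Set
    λ≥ω   : Σ (ℕ → I) (Injective _≡_ _≡_)
    a     : (α : Fin 2) → I → Env M (m α)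
    row-inconsistent : (α : Fin 2) (f : Fin (k α) → I) → Injective _≡_ _≡_ f →
                       ¬ (Σ Carrier λ c → (j : Fin (k α)) → Sat M (φ α) (extend M c (a α (f j))))
    path-consistent : (η : Fin 2 → I) →
                      Σ Carrier λ c → (α : Fin 2) → Sat M (φ α) (extend M c (a α (η α)))

InpMinimal : {L : Signature} → Structure L → Set₁
InpMinimal {L} G = (M : Structure L) → M ≡ₑ G → ¬ InpPattern₂ M

record OGSignature : Set₁ where
  field
    sig : Signature
  open Signature sig public
  field
    mulS : FunSym 2
    invS : FunSym 1
    oneS : FunSym 0
    ltS  : RelSym 2

module _ (L : OGSignature) (G : Structure (OGSignature.sig L)) where
  open OGSignature L
  open Structure G

  _·_ : Carrier → Carrier → Carrier
  x · y = funI mulS (x ∷ y ∷ [])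

  _⁻¹ : Carrier → Carrier
  x ⁻¹ = funI invS (x ∷ [])

  e : Carrier
  e = funI oneS []

  _<_ : Carrier → Carrier → Set
  x < y = relI ltS (x ∷ y ∷ [])

  record IsOrderedGroup : Set where
    field
      assoc     : ∀ x y z → (x · y) · z ≡ x · (y · z)
      identityˡ : ∀ x → e · x ≡ x
      identityʳ : ∀ x → x · e ≡ x
      inverseˡ  : ∀ x → (x ⁻¹) · x ≡ e
      inverseʳ  : ∀ x → x · (x ⁻¹) ≡ e
      irrefl    : ∀ x → ¬ (x < x)
      trans     : ∀ x y z → x < y → y < z → x < z
      total     : ∀ x y → x < y ⊎ (x ≡ y ⊎ y < x)
      left-inv  : ∀ x y z → x < y → (z · x) < (z · y)
      right-inv : ∀ x y z → x < y → (x · z) < (y · z)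

  IsAbelian : Set
  IsAbelian = ∀ x y → x · y ≡ y · x

-- Write conj g u = g u g⁻¹.  Suppose p and q do not commute.  Comparing an
-- element h with conj g h either shows that g and h commute or produces
-- u ∈ {h, h⁻¹} that commutes with h and is moved upwards by g
-- ('displacement').  Applied twice this yields s, t with
--     s < q s q⁻¹,   t < s⁻¹ t s,   q t = t q.
-- From such data we build an inp-pattern of length two in G itself
-- ('ConjugationPattern'): the orbits  n ↦ qⁿ s q⁻ⁿ  and  m ↦ s⁻ᵐ t sᵐ
-- are strictly increasing chains, so the open intervals between their
-- elements 3i and 3i+2 are pairwise disjoint ('StrictChain'); the rows
--     y₀ < x y₂ x⁻¹ < y₁   and   y₀ < x⁻¹ y₂ x < y₁
-- with these intervals as parameters are 2-inconsistent, while
-- x = qⁿ sᵐ realises the (n, m)-th point of both orbits at once, making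
-- every path consistent.  As G is a model of its own theory, inp-minimality
-- is contradicted; excluded middle turns this into commutativity.
module Submission where

open import Defs hiding (_⁻¹)
open import Level using (0ℓ)
open import Axiom.ExcludedMiddle using (ExcludedMiddle)
open import Algebra.Bundles using (Group)
import Algebra.Properties.Group as GroupProperties
open import Data.Nat as ℕ using (ℕ; zero; suc; s≤s; z≤n)
open import Data.Nat.Properties using (m≤n⇒m<n∨m≡n; *-suc; *-monoʳ-≤; <-cmp)
open import Data.Fin using (Fin; zero; suc)
open import Data.Vec using ([]; _∷_)
open import Data.Product using (Σ; _×_; _,_)
open import Data.Sum using (_⊎_; inj₁; inj₂)
open import Data.Empty using (⊥-elim)
open import Relation.Nullary using (¬_; yes; no)
open import Relation.Binary using (tri<; tri≈; tri>)
open import Relation.Binary.PropositionalEquality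
open import Function using (id)
open import Function.Definitions using (Injective)

≡ₑ-refl : {L : Signature} (M : Structure L) → M ≡ₑ M
≡ₑ-refl M σ = id , id

module StrictChain {A : Set} (_≺_ : A → A → Set)
  (≺-trans : ∀ {x y z} → x ≺ y → y ≺ z → x ≺ z) (≺-irrefl : ∀ {x} → ¬ (x ≺ x))
  (c : ℕ → A) (step : ∀ n → c n ≺ c (suc n)) where

  chain-mono : ∀ {n n'} → n ℕ.< n' → c n ≺ c n'
  chain-mono {n} {suc n'} (s≤s n≤n') with m≤n⇒m<n∨m≡n n≤n'
  ... | inj₁ n<n' = ≺-trans (chain-mono n<n') (step n')
  ... | inj₂ refl = step n

  lower upper : ℕ → ℕ
  lower i = 3 ℕ.* i
  upper i = suc (suc (3 ℕ.* i))

  InBlock : ℕ → A → Set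
  InBlock i u = c (lower i) ≺ u × u ≺ c (upper i)

  block-mid : ∀ i → InBlock i (c (suc (lower i)))
  block-mid i = step (lower i) , step (suc (lower i))

  upper<lower : ∀ {i j} → i ℕ.< j → upper i ℕ.< lower j
  upper<lower {i} {j} i<j = subst (ℕ._≤ 3 ℕ.* j) (*-suc 3 i) (*-monoʳ-≤ 3 i<j)

  blocks-ordered : ∀ {i j u} → i ℕ.< j → InBlock i u → ¬ InBlock j u
  blocks-ordered i<j (_ , u<upper) (lower<u , _) =
    ≺-irrefl (≺-trans (chain-mono (upper<lower i<j)) (≺-trans lower<u u<upper))

  blocks-disjoint : ∀ {i j u} → InBlock i u → InBlock j u → i ≡ j
  blocks-disjoint {i} {j} ui uj with <-cmp i j
  ... | tri< i<j _ _ = ⊥-elim (blocks-ordered i<j ui uj)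
  ... | tri≈ _ i≡j _ = i≡j
  ... | tri> _ _ j<i = ⊥-elim (blocks-ordered j<i uj ui)

module ConjugationFormulas (L : OGSignature) where
  open OGSignature L

  x y₀ y₁ y₂ : Term sig 4
  x  = var zero
  y₀ = var (suc zero)
  y₁ = var (suc (suc zero))
  y₂ = var (suc (suc (suc zero)))

  _·ₜ_ : Term sig 4 → Term sig 4 → Term sig 4
  u ·ₜ v = app mulS (u ∷ v ∷ [])

  _⁻¹ₜ : Term sig 4 → Term sig 4
  u ⁻¹ₜ = app invS (u ∷ [])

  _<ₜ_ : Term sig 4 → Term sig 4 → Formula sig 4
  u <ₜ v = rel ltS (u ∷ v ∷ [])

  _∧ₜ_ : Formula sig 4 → Formula sig 4 → Formula sig 4
  φ ∧ₜ ψ = imp (imp φ (imp ψ falsum)) falsum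

  conjugateBetween : Term sig 4 → Formula sig 4
  conjugateBetween w = (y₀ <ₜ ((w ·ₜ y₂) ·ₜ (w ⁻¹ₜ))) ∧ₜ (((w ·ₜ y₂) ·ₜ (w ⁻¹ₜ)) <ₜ y₁)

module OrderedGroupFacts (L : OGSignature) (G : Structure (OGSignature.sig L))
                         (og : IsOrderedGroup L G) where
  open OGSignature L using (sig)
  open Structure G using (Carrier)
  open IsOrderedGroup og renaming (trans to <-trans; irrefl to <-irrefl)
  open ConjugationFormulas L using (conjugateBetween; x; _⁻¹ₜ)
  open ≡-Reasoning

  infixl 7 _∙_
  infix 8 _⁻¹
  infix 4 _≺_

  _∙_ : Carrier → Carrier → Carrier
  _∙_ = _·_ L G

  _⁻¹ : Carrier → Carrier
  _⁻¹ = Defs._⁻¹ L G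

  ε : Carrier
  ε = e L G

  _≺_ : Carrier → Carrier → Set
  _≺_ = _<_ L G

  -- The underlying group, to reuse the library's group identities.
  group : Group 0ℓ 0ℓ
  group = record
    { Carrier = Carrier ; _≈_ = _≡_ ; _∙_ = _∙_ ; ε = ε ; _⁻¹ = _⁻¹
    ; isGroup = record
      { isMonoid = record
        { isSemigroup = record
          { isMagma = record { isEquivalence = isEquivalence ; ∙-cong = cong₂ _∙_ }
          ; assoc = assoc }
        ; identity = identityˡ , identityʳ }
      ; inverse = inverseˡ , inverseʳ
      ; ⁻¹-cong = cong _⁻¹ } }

  open GroupProperties group using (⁻¹-involutive; ⁻¹-anti-homo-∙)

  ≺-irrefl : ∀ {u} → ¬ (u ≺ u)
  ≺-irrefl = <-irrefl _

  ≺-trans : ∀ {u v w} → u ≺ v → v ≺ w → u ≺ w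
  ≺-trans = <-trans _ _ _

  -- Inversion reverses the order: multiply u ≺ v by v⁻¹ on the left and
  -- by u⁻¹ on the right.
  ⁻¹-antitone : ∀ {u v} → u ≺ v → v ⁻¹ ≺ u ⁻¹
  ⁻¹-antitone {u} {v} u≺v = subst₂ _≺_ v⁻¹uu⁻¹≡v⁻¹ v⁻¹vu⁻¹≡u⁻¹
                               (right-inv _ _ (u ⁻¹) (left-inv u v (v ⁻¹) u≺v))
    where
    v⁻¹uu⁻¹≡v⁻¹ : v ⁻¹ ∙ u ∙ u ⁻¹ ≡ v ⁻¹
    v⁻¹uu⁻¹≡v⁻¹ = begin
      v ⁻¹ ∙ u ∙ u ⁻¹   ≡⟨ assoc _ _ _ ⟩
      v ⁻¹ ∙ (u ∙ u ⁻¹) ≡⟨ cong (v ⁻¹ ∙_) (inverseʳ u) ⟩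
      v ⁻¹ ∙ ε          ≡⟨ identityʳ _ ⟩
      v ⁻¹              ∎
    v⁻¹vu⁻¹≡u⁻¹ : v ⁻¹ ∙ v ∙ u ⁻¹ ≡ u ⁻¹
    v⁻¹vu⁻¹≡u⁻¹ = trans (cong (_∙ u ⁻¹) (inverseˡ v)) (identityˡ _)

  Commute : Carrier → Carrier → Set
  Commute g h = g ∙ h ≡ h ∙ g

  commute-sym : ∀ {g h} → Commute g h → Commute h g
  commute-sym = sym

  -- If g commutes with h, so does g⁻¹: conjugate g h = h g by g⁻¹.
  commute-⁻¹ : ∀ {g h} → Commute g h → Commute (g ⁻¹) h
  commute-⁻¹ {g} {h} gh≡hg = begin
    g ⁻¹ ∙ h                  ≡⟨ cong (g ⁻¹ ∙_) (sym (identityʳ h)) ⟩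
    g ⁻¹ ∙ (h ∙ ε)            ≡⟨ cong (λ z → g ⁻¹ ∙ (h ∙ z)) (sym (inverseʳ g)) ⟩
    g ⁻¹ ∙ (h ∙ (g ∙ g ⁻¹))   ≡⟨ cong (g ⁻¹ ∙_) (sym (assoc h g (g ⁻¹))) ⟩
    g ⁻¹ ∙ (h ∙ g ∙ g ⁻¹)     ≡⟨ cong (λ z → g ⁻¹ ∙ (z ∙ g ⁻¹)) (sym gh≡hg) ⟩
    g ⁻¹ ∙ (g ∙ h ∙ g ⁻¹)     ≡⟨ cong (g ⁻¹ ∙_) (assoc g h (g ⁻¹)) ⟩
    g ⁻¹ ∙ (g ∙ (h ∙ g ⁻¹))   ≡⟨ sym (assoc _ _ _) ⟩
    g ⁻¹ ∙ g ∙ (h ∙ g ⁻¹)     ≡⟨ cong (_∙ (h ∙ g ⁻¹)) (inverseˡ g) ⟩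
    ε ∙ (h ∙ g ⁻¹)            ≡⟨ identityˡ _ ⟩
    h ∙ g ⁻¹                  ∎

  commute-⁻¹-self : ∀ g → Commute (g ⁻¹) g
  commute-⁻¹-self g = commute-⁻¹ refl

  _^_ : Carrier → ℕ → Carrier
  g ^ zero  = ε
  g ^ suc n = g ^ n ∙ g

  commute-^ : ∀ {g h} n → Commute g h → Commute (g ^ n) h
  commute-^ {g} {h} zero    _      = trans (identityˡ h) (sym (identityʳ h))
  commute-^ {g} {h} (suc n) gh≡hg = begin
    g ^ n ∙ g ∙ h     ≡⟨ assoc _ _ _ ⟩
    g ^ n ∙ (g ∙ h)   ≡⟨ cong (g ^ n ∙_) gh≡hg ⟩
    g ^ n ∙ (h ∙ g)   ≡⟨ sym (assoc _ _ _) ⟩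
    g ^ n ∙ h ∙ g     ≡⟨ cong (_∙ g) (commute-^ n gh≡hg) ⟩
    h ∙ g ^ n ∙ g     ≡⟨ assoc _ _ _ ⟩
    h ∙ (g ^ n ∙ g)   ∎

  conj : Carrier → Carrier → Carrier
  conj g u = g ∙ u ∙ g ⁻¹

  conj-∙ : ∀ g h u → conj (g ∙ h) u ≡ conj g (conj h u)
  conj-∙ g h u = begin
    g ∙ h ∙ u ∙ (g ∙ h) ⁻¹          ≡⟨ cong₂ _∙_ (assoc g h u) (⁻¹-anti-homo-∙ g h) ⟩
    g ∙ (h ∙ u) ∙ (h ⁻¹ ∙ g ⁻¹)    ≡⟨ sym (assoc _ _ _) ⟩
    g ∙ (h ∙ u) ∙ h ⁻¹ ∙ g ⁻¹      ≡⟨ cong (_∙ g ⁻¹) (assoc _ _ _) ⟩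
    g ∙ (h ∙ u ∙ h ⁻¹) ∙ g ⁻¹      ∎

  commute⇒conj-fixed : ∀ {g u} → Commute g u → conj g u ≡ u
  commute⇒conj-fixed {g} {u} gu≡ug = begin
    g ∙ u ∙ g ⁻¹     ≡⟨ cong (_∙ g ⁻¹) gu≡ug ⟩
    u ∙ g ∙ g ⁻¹     ≡⟨ assoc _ _ _ ⟩
    u ∙ (g ∙ g ⁻¹)   ≡⟨ cong (u ∙_) (inverseʳ g) ⟩
    u ∙ ε            ≡⟨ identityʳ u ⟩
    u                ∎

  conj-fixed⇒commute : ∀ {g u} → conj g u ≡ u → Commute g u
  conj-fixed⇒commute {g} {u} gug⁻¹≡u = begin
    g ∙ u                ≡⟨ sym (identityʳ _) ⟩
    g ∙ u ∙ ε            ≡⟨ cong (g ∙ u ∙_) (sym (inverseˡ g)) ⟩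
    g ∙ u ∙ (g ⁻¹ ∙ g)   ≡⟨ sym (assoc _ _ _) ⟩
    conj g u ∙ g         ≡⟨ cong (_∙ g) gug⁻¹≡u ⟩
    u ∙ g                ∎

  conj-⁻¹ : ∀ g u → conj g (u ⁻¹) ≡ (conj g u) ⁻¹
  conj-⁻¹ g u = sym (begin
    (g ∙ u ∙ g ⁻¹) ⁻¹          ≡⟨ ⁻¹-anti-homo-∙ _ _ ⟩
    g ⁻¹ ⁻¹ ∙ (g ∙ u) ⁻¹       ≡⟨ cong₂ _∙_ (⁻¹-involutive g) (⁻¹-anti-homo-∙ g u) ⟩
    g ∙ (u ⁻¹ ∙ g ⁻¹)          ≡⟨ sym (assoc _ _ _) ⟩
    g ∙ u ⁻¹ ∙ g ⁻¹            ∎)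

  conj-mono : ∀ g {u v} → u ≺ v → conj g u ≺ conj g v
  conj-mono g {u} {v} u≺v = right-inv _ _ (g ⁻¹) (left-inv u v g u≺v)

  orbit-step : ∀ {g u} → u ≺ conj g u → ∀ n → conj (g ^ n) u ≺ conj (g ^ suc n) u
  orbit-step {g} {u} u≺gug⁻¹ n =
    subst (conj (g ^ n) u ≺_) (sym (conj-∙ (g ^ n) g u)) (conj-mono (g ^ n) u≺gug⁻¹)

  displace : ∀ g h → Commute g h ⊎ Σ Carrier (λ u → u ≺ conj g u × Commute h u)
  displace g h with total h (conj g h)
  ... | inj₁ h≺ghg⁻¹        = inj₂ (h , h≺ghg⁻¹ , refl)
  ... | inj₂ (inj₁ h≡ghg⁻¹) = inj₁ (conj-fixed⇒commute (sym h≡ghg⁻¹))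
  ... | inj₂ (inj₂ ghg⁻¹≺h) =
    inj₂ (h ⁻¹ , subst (h ⁻¹ ≺_) (sym (conj-⁻¹ g h)) (⁻¹-antitone ghg⁻¹≺h)
              , commute-sym (commute-⁻¹-self h))

  -- The element aⁿ (bᵐ)⁻¹ conjugates u to aⁿ u a⁻ⁿ
  -- and, inverted, v to bᵐ v b⁻ᵐ, so it realises any path.
  module ConjugationPattern (a b u v : Carrier)
    (u≺aua⁻¹ : u ≺ conj a u) (v≺bvb⁻¹ : v ≺ conj b v)
    (bu≡ub : Commute b u) (av≡va : Commute a v) where

    orbitᵤ orbitᵥ : ℕ → Carrier
    orbitᵤ n = conj (a ^ n) u
    orbitᵥ m = conj (b ^ m) v

    module Cᵤ = StrictChain _≺_ ≺-trans ≺-irrefl orbitᵤ (orbit-step u≺aua⁻¹)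
    module Cᵥ = StrictChain _≺_ ≺-trans ≺-irrefl orbitᵥ (orbit-step v≺bvb⁻¹)

    witness : ℕ → ℕ → Carrier
    witness n m = a ^ n ∙ (b ^ m) ⁻¹

    witness-conjᵤ : ∀ n m → conj (witness n m) u ≡ orbitᵤ n
    witness-conjᵤ n m = begin
      conj (a ^ n ∙ (b ^ m) ⁻¹) u        ≡⟨ conj-∙ _ _ u ⟩
      conj (a ^ n) (conj ((b ^ m) ⁻¹) u) ≡⟨ cong (conj (a ^ n))
                                              (commute⇒conj-fixed (commute-⁻¹ (commute-^ m bu≡ub))) ⟩
      conj (a ^ n) u                     ∎

    witness-conjᵥ : ∀ n m → conj (witness n m ⁻¹) v ≡ orbitᵥ m
    witness-conjᵥ n m = begin
      conj ((a ^ n ∙ (b ^ m) ⁻¹) ⁻¹) v   ≡⟨ cong (λ z → conj z v) (⁻¹-anti-homo-∙ _ _) ⟩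
      conj ((b ^ m) ⁻¹ ⁻¹ ∙ (a ^ n) ⁻¹) v ≡⟨ cong (λ z → conj (z ∙ (a ^ n) ⁻¹) v) (⁻¹-involutive _) ⟩
      conj (b ^ m ∙ (a ^ n) ⁻¹) v        ≡⟨ conj-∙ _ _ v ⟩
      conj (b ^ m) (conj ((a ^ n) ⁻¹) v) ≡⟨ cong (conj (b ^ m))
                                              (commute⇒conj-fixed (commute-⁻¹ (commute-^ n av≡va))) ⟩
      conj (b ^ m) v                     ∎

    φ : Fin 2 → Formula sig 4
    φ zero       = conjugateBetween x
    φ (suc zero) = conjugateBetween (x ⁻¹ₜ)

    parameters : Carrier → Carrier → Carrier → Env G 3
    parameters lo hi w zero             = lo
    parameters lo hi w (suc zero)       = hi
    parameters lo hi w (suc (suc zero)) = w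

    array : Fin 2 → ℕ → Env G 3
    array zero       i = parameters (orbitᵤ (Cᵤ.lower i)) (orbitᵤ (Cᵤ.upper i)) u
    array (suc zero) i = parameters (orbitᵥ (Cᵥ.lower i)) (orbitᵥ (Cᵥ.upper i)) v

    distinct-instances : {f : Fin 2 → ℕ} → Injective _≡_ _≡_ f → ¬ f zero ≡ f (suc zero)
    distinct-instances f-inj f₀≡f₁ with f-inj f₀≡f₁
    ... | ()

    -- Two distinct instances of a row would put one conjugate in two
    -- disjoint blocks.
    row-inconsistent : (α : Fin 2) (f : Fin 2 → ℕ) → Injective _≡_ _≡_ f →
      ¬ Σ Carrier (λ c → (j : Fin 2) → Sat G (φ α) (extend G c (array α (f j))))
    row-inconsistent zero f f-inj (c , sat) =
      sat zero λ l₀ u₀ → sat (suc zero) λ l₁ u₁ →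
        distinct-instances f-inj (Cᵤ.blocks-disjoint (l₀ , u₀) (l₁ , u₁))
    row-inconsistent (suc zero) f f-inj (c , sat) =
      sat zero λ l₀ u₀ → sat (suc zero) λ l₁ u₁ →
        distinct-instances f-inj (Cᵥ.blocks-disjoint (l₀ , u₀) (l₁ , u₁))

    -- The path η is realised by the witness for the midpoints of blocks
    -- η 0 and η 1.
    path-consistent : (η : Fin 2 → ℕ) →
      Σ Carrier (λ c → (α : Fin 2) → Sat G (φ α) (extend G c (array α (η α))))
    path-consistent η = witness n m , λ
      { zero       k → inBlock (subst (Cᵤ.InBlock (η zero)) (sym (witness-conjᵤ n m))
                                       (Cᵤ.block-mid (η zero))) k
      ; (suc zero) k → inBlock (subst (Cᵥ.InBlock (η (suc zero))) (sym (witness-conjᵥ n m))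
                                       (Cᵥ.block-mid (η (suc zero)))) k }
      where
      n m : ℕ
      n = suc (Cᵤ.lower (η zero))
      m = suc (Cᵥ.lower (η (suc zero)))
      inBlock : {P Q : Set} → P × Q → ¬ (P → ¬ Q)
      inBlock (p , q) k = k p q

    inpPattern : InpPattern₂ G
    inpPattern = record
      { m = λ _ → 3 ; φ = φ ; k = λ _ → 2 ; k-pos = λ _ → s≤s z≤n
      ; I = ℕ ; λ≥ω = id , id ; a = array
      ; row-inconsistent = row-inconsistent ; path-consistent = path-consistent }

  noncommuting⇒pattern : ∀ p q → ¬ Commute p q → InpPattern₂ G
  noncommuting⇒pattern p q p∤q with displace q p
  ... | inj₁ qp≡pq = ⊥-elim (p∤q (commute-sym qp≡pq))
  ... | inj₂ (s , s≺qsq⁻¹ , _) with displace (s ⁻¹) q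
  ...   | inj₁ s⁻¹q≡qs⁻¹ = ⊥-elim (≺-irrefl (subst (s ≺_) (commute⇒conj-fixed q∙s≡s∙q) s≺qsq⁻¹))
    where q∙s≡s∙q : Commute q s
          q∙s≡s∙q = commute-sym (subst (λ z → Commute z q) (⁻¹-involutive s) (commute-⁻¹ s⁻¹q≡qs⁻¹))
  ...   | inj₂ (t , t≺s⁻¹ts , qt≡tq) =
    ConjugationPattern.inpPattern q (s ⁻¹) s t s≺qsq⁻¹ t≺s⁻¹ts (commute-⁻¹-self s) qt≡tq

proposition3p3 : ExcludedMiddle 0ℓ →
    (L : OGSignature) (G : Structure (OGSignature.sig L)) →
    IsOrderedGroup L G → InpMinimal G → IsAbelian L G
proposition3p3 em L G og inp-minimal p q with em {_·_ L G p q ≡ _·_ L G q p}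
... | yes pq≡qp = pq≡qp
... | no  p∤q   = ⊥-elim (inp-minimal G (≡ₑ-refl G) (noncommuting⇒pattern p q p∤q))
  where open OrderedGroupFacts L G og using (noncommuting⇒pattern)
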